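{- Let $e_0,e_1,\dots$ be integers and $\mu$ a parameter. For $n\geq1$ let $M_n$ be the $n\times n$ tridiagonal matrix with diagonal $(e_0,\dots,e_{n-1})$ and all sub- and superdiagonal entries $1$, let $\chi_{M_0}=1$, and set $f_n(y)=\chi_{M_n}(2y+\mu)$. Then for every $n\geq0$, $$f_n=U_n+\sum_{k=0}^{n-1}(\mu-e_k)f_kU_{n-k-1}.$$
   Context: $\chi_M(x)=\det(xI-M)$. The Chebyshev polynomials of the second kind are $U_0(y)=1$, $U_1(y)=2y$, $U_{n+1}(y)=2yU_n(y)-U_{n-1}(y)$, with the convention $U_{ -1}=0$. -}

module Defs where

open import Level using (Level)
open import Data.Nat using (ℕ; zero; suc; _∸_)
open import Data.Nat.Properties using (_≟_)
open import Data.Integer using (ℤ; +_; -[1+_])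
open import Data.Fin using (Fin; zero; suc; toℕ; punchIn)
open import Data.Bool using (true; false)
open import Relation.Nullary using (yes; no)
open import Algebra.Bundles using (CommutativeRing)

module _ {c ℓ : Level} (R : CommutativeRing c ℓ) where
  open CommutativeRing R using (Carrier; _+_; _*_; -_; _-_; 0#; 1#)

  natR : ℕ → Carrier
  natR zero = 0#
  natR (suc n) = 1# + natR n

  intR : ℤ → Carrier
  intR (+ n) = natR n
  intR -[1+ n ] = - natR (suc n)

  ΣFin : (n : ℕ) → (Fin n → Carrier) → Carrier
  ΣFin zero g = 0#
  ΣFin (suc n) g = g zero + ΣFin n (λ j → g (suc j))

  Σ< : ℕ → (ℕ → Carrier) → Carrier
  Σ< zero g = 0#
  Σ< (suc n) g = Σ< n g + g n

  sign : ℕ → Carrier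
  sign zero = 1#
  sign (suc k) = - sign k

  det : (n : ℕ) → (Fin n → Fin n → Carrier) → Carrier
  det zero A = 1#
  det (suc n) A =
    ΣFin (suc n) (λ j → sign (toℕ j) * (A zero j * det n (λ r s → A (suc r) (punchIn j s))))

  idMat : (n : ℕ) → Fin n → Fin n → Carrier
  idMat n i j with toℕ i ≟ toℕ j
  ... | yes _ = 1#
  ... | no _ = 0#

  triMat : (ℕ → ℤ) → (n : ℕ) → Fin n → Fin n → Carrier
  triMat e n i j with toℕ i ≟ toℕ j | suc (toℕ i) ≟ toℕ j | toℕ i ≟ suc (toℕ j)
  ... | yes _ | _ | _ = intR (e (toℕ i))
  ... | no _ | yes _ | _ = 1#
  ... | no _ | no _ | yes _ = 1#
  ... | no _ | no _ | no _ = 0#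

  charPoly : (n : ℕ) → (Fin n → Fin n → Carrier) → Carrier → Carrier
  charPoly n M x = det n (λ i j → x * idMat n i j - M i j)

  fPoly : (ℕ → ℤ) → Carrier → ℕ → Carrier → Carrier
  fPoly e μ n y = charPoly n (triMat e n) ((y + y) + μ)

  cheb : ℕ → Carrier → Carrier
  cheb zero y = 1#
  cheb (suc zero) y = y + y
  cheb (suc (suc n)) y = ((y + y) * cheb (suc n) y) - cheb n y

-- Put x = 2y + μ and D_n = χ_{M_n}(x). Expanding det(x I − M_{n+2}) along its first row, whose only
-- nonzero entries are the first two, gives D_{n+2} = (x − e_0) D′_{n+1} − D″_n, where D′ and D″ come from
-- the matrices with the first one or two indices removed; induction turns this into the three-term
-- recurrence D_{n+2} = (x − e_{n+1}) D_{n+1} − D_n. Since x − e_{n+1} = 2y + (μ − e_{n+1}), this is the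
-- Chebyshev recurrence U_{n+2} = 2y U_{n+1} − U_n perturbed by a_{n+1} = (μ − e_{n+1}) D_{n+1}. With the
-- convention U_{−1} = 0 the convolution Σ_{k<n} a_k U_{n−k−1} satisfies the same perturbed recurrence with
-- initial values 0, 0, so D_n minus it satisfies Chebyshev's recurrence with the initial values of U_n.
module Submission where

open import Defs
open import Level using (Level)
open import Data.Nat using (ℕ; zero; suc; _∸_; _<_; _≤_; _≟_; s≤s; z≤n; s≤s⁻¹)
import Data.Nat as ℕ
open import Data.Nat.Properties
  using (+-suc; m<n⇒m<1+n; n<1+n; 1+n≢n; <⇒≢; >⇒≢; <⇒≤; +-∸-assoc; n∸n≡0; m+n∸n≡m; m<n⇒0<n∸m)
open import Data.Integer using (ℤ; +_; -[1+_]; _⊖_; _◃_)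
import Data.Integer as ℤ
import Data.Integer.Properties as ℤ
import Data.Sign as Sign
open import Data.Fin using (Fin; zero; suc; toℕ; punchIn)
open import Data.Maybe using (Maybe; just; nothing)
open import Data.Product using (_×_; _,_; proj₁; proj₂)
open import Data.Empty using (⊥-elim)
open import Relation.Nullary using (yes; no)
open import Relation.Binary.PropositionalEquality as ≡ using (_≡_; _≢_)
open import Algebra.Bundles using (CommutativeRing)
import Algebra.Solver.Ring
open import Algebra.Solver.Ring.AlmostCommutativeRing
  using (fromCommutativeRing; _-Raw-AlmostCommutative⟶_)

module _ {r ℓ : Level} (R : CommutativeRing r ℓ) where
  open CommutativeRing R hiding (zero)
  open import Algebra.Properties.Ring ring
    using (-0#≈0#; -1*x≈-x; -‿involutive; -‿+-comm; -‿distribˡ-*; -‿distribʳ-*; xyx⁻¹≈y)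
  open import Algebra.Properties.Semiring.Mult.TCOptimised semiring
    using (1+×; ×-homo-+; ×1-homo-*) renaming (_×_ to _×′_)
  open import Relation.Binary.Reasoning.Setoid setoid

  -- Integer coefficients for the ring solver: its normal forms only cancel if coefficients compute.

  ⟦_⟧ : ℤ → Carrier
  ⟦ + n ⟧ = n ×′ 1#
  ⟦ -[1+ n ] ⟧ = - (suc n ×′ 1#)

  ⟦⊖⟧ : ∀ m n → ⟦ m ⊖ n ⟧ ≈ m ×′ 1# - n ×′ 1#
  ⟦⊖⟧ m zero = begin
    m ×′ 1#       ≈⟨ +-identityʳ _ ⟨
    m ×′ 1# + 0#  ≈⟨ +-congˡ -0#≈0# ⟨
    m ×′ 1# - 0#  ∎
  ⟦⊖⟧ zero (suc n) = sym (+-identityˡ _)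
  ⟦⊖⟧ (suc m) (suc n) = begin
    ⟦ suc m ⊖ suc n ⟧          ≡⟨ ≡.cong ⟦_⟧ (ℤ.[1+m]⊖[1+n]≡m⊖n m n) ⟩
    ⟦ m ⊖ n ⟧                  ≈⟨ ⟦⊖⟧ m n ⟩
    a - b                      ≈⟨ +-congʳ (xyx⁻¹≈y 1# a) ⟨
    1# + a - 1# - b            ≈⟨ +-assoc _ _ _ ⟩
    (1# + a) + (- 1# - b)      ≈⟨ +-congˡ (-‿+-comm 1# b) ⟩
    (1# + a) - (1# + b)        ≈⟨ +-cong (1+× m 1#) (-‿cong (1+× n 1#)) ⟨
    suc m ×′ 1# - suc n ×′ 1#  ∎
    where a = m ×′ 1#; b = n ×′ 1#

  ⟦+◃⟧ : ∀ n → ⟦ Sign.+ ◃ n ⟧ ≈ n ×′ 1#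
  ⟦+◃⟧ zero = refl
  ⟦+◃⟧ (suc n) = refl

  ⟦-◃⟧ : ∀ n → ⟦ Sign.- ◃ n ⟧ ≈ - (n ×′ 1#)
  ⟦-◃⟧ zero = sym -0#≈0#
  ⟦-◃⟧ (suc n) = refl

  ⟦-⟧ : ∀ i → ⟦ ℤ.- i ⟧ ≈ - ⟦ i ⟧
  ⟦-⟧ (+ zero) = sym -0#≈0#
  ⟦-⟧ (+ suc n) = refl
  ⟦-⟧ -[1+ n ] = sym (-‿involutive _)

  ⟦+⟧ : ∀ i j → ⟦ i ℤ.+ j ⟧ ≈ ⟦ i ⟧ + ⟦ j ⟧
  ⟦+⟧ (+ m) (+ n) = ×-homo-+ 1# m n
  ⟦+⟧ (+ m) -[1+ n ] = ⟦⊖⟧ m (suc n)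
  ⟦+⟧ -[1+ m ] (+ n) = trans (⟦⊖⟧ n (suc m)) (+-comm _ _)
  ⟦+⟧ -[1+ m ] -[1+ n ] = begin
    - (suc (suc (m ℕ.+ n)) ×′ 1#)      ≡⟨ ≡.cong (λ k → - (suc k ×′ 1#)) (+-suc m n) ⟨
    - ((suc m ℕ.+ suc n) ×′ 1#)        ≈⟨ -‿cong (×-homo-+ 1# (suc m) (suc n)) ⟩
    - (suc m ×′ 1# + suc n ×′ 1#)      ≈⟨ -‿+-comm _ _ ⟨
    - (suc m ×′ 1#) + - (suc n ×′ 1#)  ∎

  ⟦*⟧ : ∀ i j → ⟦ i ℤ.* j ⟧ ≈ ⟦ i ⟧ * ⟦ j ⟧
  ⟦*⟧ (+ m) (+ n) = trans (⟦+◃⟧ (m ℕ.* n)) (×1-homo-* m n)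
  ⟦*⟧ (+ m) -[1+ n ] =
    trans (⟦-◃⟧ (m ℕ.* suc n)) (trans (-‿cong (×1-homo-* m (suc n))) (-‿distribʳ-* _ _))
  ⟦*⟧ -[1+ m ] (+ n) =
    trans (⟦-◃⟧ (suc m ℕ.* n)) (trans (-‿cong (×1-homo-* (suc m) n)) (-‿distribˡ-* _ _))
  ⟦*⟧ -[1+ m ] -[1+ n ] = begin
    ⟦ Sign.+ ◃ (suc m ℕ.* suc n) ⟧  ≈⟨ ⟦+◃⟧ (suc m ℕ.* suc n) ⟩
    (suc m ℕ.* suc n) ×′ 1#         ≈⟨ ×1-homo-* (suc m) (suc n) ⟩
    a * b                           ≈⟨ -‿involutive _ ⟨
    - - (a * b)                     ≈⟨ -‿cong (-‿distribˡ-* a b) ⟩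
    - (- a * b)                     ≈⟨ -‿distribʳ-* (- a) b ⟩
    - a * - b                       ∎
    where a = suc m ×′ 1#; b = suc n ×′ 1#

  ℤ-coefficients :
    CommutativeRing.rawRing ℤ.+-*-commutativeRing -Raw-AlmostCommutative⟶ fromCommutativeRing R
  ℤ-coefficients = record
    { ⟦_⟧ = ⟦_⟧
    ; +-homo = ⟦+⟧
    ; *-homo = ⟦*⟧
    ; -‿homo = ⟦-⟧
    ; 0-homo = refl
    ; 1-homo = refl
    }

  ⟦≟⟧ : ∀ i j → Maybe (⟦ i ⟧ ≈ ⟦ j ⟧)
  ⟦≟⟧ i j with i ℤ.≟ j
  ... | yes i≡j = just (reflexive (≡.cong ⟦_⟧ i≡j))
  ... | no _ = nothing

  open Algebra.Solver.Ring _ _ ℤ-coefficients ⟦≟⟧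
    using (Polynomial; solve; _:+_; _:*_; _:-_; :-_; _:=_; con)

  :0 :1 : ∀ {n} → Polynomial n
  :0 = con (+ 0)
  :1 = con (+ 1)

  ΣFin-cong : ∀ n {f g : Fin n → Carrier} → (∀ j → f j ≈ g j) → ΣFin R n f ≈ ΣFin R n g
  ΣFin-cong zero f≈g = refl
  ΣFin-cong (suc n) f≈g = +-cong (f≈g zero) (ΣFin-cong n (λ j → f≈g (suc j)))

  ΣFin-zero : ∀ n {f : Fin n → Carrier} → (∀ j → f j ≈ 0#) → ΣFin R n f ≈ 0#
  ΣFin-zero zero f≈0 = refl
  ΣFin-zero (suc n) f≈0 =
    trans (+-cong (f≈0 zero) (ΣFin-zero n (λ j → f≈0 (suc j)))) (+-identityʳ 0#)

  Σ<-cong : ∀ n {f g : ℕ → Carrier} → (∀ {k} → k < n → f k ≈ g k) → Σ< R n f ≈ Σ< R n g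
  Σ<-cong zero f≈g = refl
  Σ<-cong (suc n) f≈g = +-cong (Σ<-cong n (λ k<n → f≈g (m<n⇒m<1+n k<n))) (f≈g (n<1+n n))

  Σ<-linear : ∀ n a (f g : ℕ → Carrier) →
    Σ< R n (λ k → a * f k - g k) ≈ a * Σ< R n f - Σ< R n g
  Σ<-linear zero a f g = solve 1 (λ a → :0 := a :* :0 :- :0) refl a
  Σ<-linear (suc n) a f g = begin
    Σ< R n (λ k → a * f k - g k) + (a * f n - g n)  ≈⟨ +-congʳ (Σ<-linear n a f g) ⟩
    (a * F - G) + (a * f n - g n)                    ≈⟨ distribute a F G (f n) (g n) ⟩
    a * (F + f n) - (G + g n)                        ∎
    where
    F = Σ< R n f; G = Σ< R n g
    distribute : ∀ a F G u v → (a * F - G) + (a * u - v) ≈ a * (F + u) - (G + v)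
    distribute = solve 5 (λ a F G u v → (a :* F :- G) :+ (a :* u :- v) := a :* (F :+ u) :- (G :+ v)) refl

  det-cong : ∀ n {A B : Fin n → Fin n → Carrier} → (∀ i j → A i j ≈ B i j) → det R n A ≈ det R n B
  det-cong zero A≈B = refl
  det-cong (suc n) A≈B = ΣFin-cong (suc n) λ j →
    *-congˡ {x = sign R (toℕ j)} (*-cong (A≈B zero j) (det-cong n (λ r s → A≈B (suc r) (punchIn j s))))

  x*[0*y]≈0 : ∀ x {y} z → y ≈ 0# → x * (y * z) ≈ 0#
  x*[0*y]≈0 x z y≈0 = trans (*-congˡ (trans (*-congʳ y≈0) (zeroˡ z))) (zeroʳ x)

  x*[y*0]≈0 : ∀ x y {z} → z ≈ 0# → x * (y * z) ≈ 0#
  x*[y*0]≈0 x y z≈0 = trans (*-congˡ (trans (*-congˡ z≈0) (zeroʳ y))) (zeroʳ x)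

  mutual
    det-firstColumn-zero : ∀ n (A : Fin (suc n) → Fin (suc n) → Carrier) →
      (∀ i → A i zero ≈ 0#) → det R (suc n) A ≈ 0#
    det-firstColumn-zero n A col≈0 = begin
      det R (suc n) A                                    ≈⟨ det-firstColumn-head n A (λ i → col≈0 (suc i)) ⟩
      A zero zero * det R n (λ r s → A (suc r) (suc s))  ≈⟨ *-congʳ (col≈0 zero) ⟩
      0# * det R n (λ r s → A (suc r) (suc s))           ≈⟨ zeroˡ _ ⟩
      0#                                                 ∎

    det-firstColumn-head : ∀ n (A : Fin (suc n) → Fin (suc n) → Carrier) →
      (∀ i → A (suc i) zero ≈ 0#) → det R (suc n) A ≈ A zero zero * det R n (λ r s → A (suc r) (suc s))
    det-firstColumn-head n A below≈0 =
      trans (+-cong (*-identityˡ _) (otherTerms n A below≈0)) (+-identityʳ _)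
      where
      otherTerms : ∀ n (A : Fin (suc n) → Fin (suc n) → Carrier) → (∀ i → A (suc i) zero ≈ 0#) →
        ΣFin R n (λ j → sign R (toℕ (suc j)) *
                          (A zero (suc j) * det R n (λ r s → A (suc r) (punchIn (suc j) s)))) ≈ 0#
      otherTerms zero A below≈0 = refl
      otherTerms (suc m) A below≈0 = ΣFin-zero (suc m) λ j →
        x*[y*0]≈0 (sign R (toℕ (suc j))) (A zero (suc j))
          (det-firstColumn-zero m (λ r s → A (suc r) (punchIn (suc j) s)) below≈0)

  -- Leading principal minors of tridiagonal matrices

  principalMinor : (ℕ → ℕ → Carrier) → ℕ → Carrier
  principalMinor A n = det R n (λ i j → A (toℕ i) (toℕ j))

  shift : (ℕ → ℕ → Carrier) → ℕ → ℕ → Carrier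
  shift A i j = A (suc i) (suc j)

  Tridiagonal : (ℕ → ℕ → Carrier) → Set ℓ
  Tridiagonal A = ∀ {i j} → suc i < j → A i j ≈ 0# × A j i ≈ 0#

  Tridiagonal-shift : ∀ {A} → Tridiagonal A → Tridiagonal (shift A)
  Tridiagonal-shift tri i<j = tri (s≤s i<j)

  principalMinor-1 : ∀ A → principalMinor A 1 ≈ A 0 0
  principalMinor-1 A = solve 1 (λ a → :1 :* (a :* :1) :+ :0 := a) refl (A 0 0)

  principalMinor-expand : ∀ {A} → Tridiagonal A → ∀ n →
    principalMinor A (2 ℕ.+ n) ≈
      A 0 0 * principalMinor (shift A) (suc n) - (A 0 1 * A 1 0) * principalMinor (shift (shift A)) n
  principalMinor-expand {A} tri n = begin
    principalMinor A (2 ℕ.+ n)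
      ≈⟨ +-congˡ (+-cong (*-congˡ (*-congˡ (det-firstColumn-head n minor₀₁ λ _ → proj₂ (tri 1<2+k))))
                          (ΣFin-zero n λ j → x*[0*y]≈0 (sign R (2 ℕ.+ toℕ j)) _ (proj₁ (tri 1<2+k)))) ⟩
    1# * (a * P) + (- 1# * (b * (b′ * Q)) + 0#)
      ≈⟨ simplify a P b b′ Q ⟩
    a * P - (b * b′) * Q ∎
    where
    a = A 0 0; b = A 0 1; b′ = A 1 0
    P = principalMinor (shift A) (suc n); Q = principalMinor (shift (shift A)) n
    minor₀₁ : Fin (suc n) → Fin (suc n) → Carrier
    minor₀₁ r s = A (suc (toℕ r)) (toℕ (punchIn (suc zero) s))
    1<2+k : ∀ {k} → 1 < 2 ℕ.+ k
    1<2+k = s≤s (s≤s z≤n)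
    simplify : ∀ a P b b′ Q → 1# * (a * P) + (- 1# * (b * (b′ * Q)) + 0#) ≈ a * P - (b * b′) * Q
    simplify = solve 5 (λ a P b b′ Q →
      :1 :* (a :* P) :+ (:- :1 :* (b :* (b′ :* Q)) :+ :0) := a :* P :- b :* b′ :* Q) refl

  principalMinor-recurrence : ∀ {A} → Tridiagonal A → ∀ n →
    principalMinor A (2 ℕ.+ n) ≈
      A (suc n) (suc n) * principalMinor A (suc n) - (A n (suc n) * A (suc n) n) * principalMinor A n
  principalMinor-recurrence {A} tri zero = begin
    principalMinor A 2                           ≈⟨ principalMinor-expand tri 0 ⟩
    A 0 0 * principalMinor (shift A) 1 - β * 1#  ≈⟨ +-congʳ (*-congˡ (principalMinor-1 (shift A))) ⟩
    A 0 0 * A 1 1 - β * 1#                       ≈⟨ +-congʳ (*-comm _ _) ⟩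
    A 1 1 * A 0 0 - β * 1#                       ≈⟨ +-congʳ (*-congˡ (principalMinor-1 A)) ⟨
    A 1 1 * principalMinor A 1 - β * 1#          ∎
    where β = A 0 1 * A 1 0
  principalMinor-recurrence {A} tri (suc zero) = begin
    principalMinor A 3
      ≈⟨ principalMinor-expand tri 1 ⟩
    a * principalMinor (shift A) 2 - β * principalMinor (shift (shift A)) 1
      ≈⟨ +-cong (*-congˡ (principalMinor-recurrence (Tridiagonal-shift tri) 0))
                (-‿cong (*-congˡ (principalMinor-1 (shift (shift A))))) ⟩
    a * (c * P - β′ * 1#) - β * c
      ≈⟨ solve 5 (λ a c P β β′ →
           a :* (c :* P :- β′ :* :1) :- β :* c := c :* (a :* P :- β :* :1) :- β′ :* a) refl a c P β β′ ⟩
    c * (a * P - β * 1#) - β′ * a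
      ≈⟨ +-cong (*-congˡ (principalMinor-expand tri 0)) (-‿cong (*-congˡ (principalMinor-1 A))) ⟨
    c * principalMinor A 2 - β′ * principalMinor A 1 ∎
    where
    a = A 0 0; c = A 2 2; β = A 0 1 * A 1 0; β′ = A 1 2 * A 2 1
    P = principalMinor (shift A) 1
  principalMinor-recurrence {A} tri (suc (suc k)) = begin
    principalMinor A (4 ℕ.+ k)
      ≈⟨ principalMinor-expand tri (2 ℕ.+ k) ⟩
    a * principalMinor (shift A) (3 ℕ.+ k) - β * principalMinor (shift (shift A)) (2 ℕ.+ k)
      ≈⟨ +-cong (*-congˡ (principalMinor-recurrence (Tridiagonal-shift tri) (suc k)))
                (-‿cong (*-congˡ (principalMinor-recurrence (Tridiagonal-shift (Tridiagonal-shift tri)) k))) ⟩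
    a * (c * P - β′ * Q) - β * (c * S - β′ * T)
      ≈⟨ solve 8 (λ a c β β′ P Q S T →
           a :* (c :* P :- β′ :* Q) :- β :* (c :* S :- β′ :* T)
             := c :* (a :* P :- β :* S) :- β′ :* (a :* Q :- β :* T)) refl a c β β′ P Q S T ⟩
    c * (a * P - β * S) - β′ * (a * Q - β * T)
      ≈⟨ +-cong (*-congˡ (principalMinor-expand tri (suc k))) (-‿cong (*-congˡ (principalMinor-expand tri k))) ⟨
    c * principalMinor A (3 ℕ.+ k) - β′ * principalMinor A (2 ℕ.+ k) ∎
    where
    a = A 0 0; β = A 0 1 * A 1 0
    c = A (3 ℕ.+ k) (3 ℕ.+ k); β′ = A (2 ℕ.+ k) (3 ℕ.+ k) * A (3 ℕ.+ k) (2 ℕ.+ k)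
    P = principalMinor (shift A) (2 ℕ.+ k); Q = principalMinor (shift A) (suc k)
    S = principalMinor (shift (shift A)) (suc k); T = principalMinor (shift (shift A)) k

  -- The characteristic polynomials χ_{M_n}

  module _ (x : Carrier) (e : ℕ → ℤ) where

    -- x I − M with ℕ indices, split into cases exactly as idMat and triMat are, so that it agrees
    -- with their entries definitionally in each case.
    charMatrix : ℕ → ℕ → Carrier
    charMatrix a b with a ≟ b | suc a ≟ b | a ≟ suc b
    ... | yes _ | _     | _     = x * 1# - intR R (e a)
    ... | no _  | yes _ | _     = x * 0# - 1#
    ... | no _  | no _  | yes _ = x * 0# - 1#
    ... | no _  | no _  | no _  = x * 0# - 0#

    charPoly≈principalMinor : ∀ n → charPoly R n (triMat R e n) x ≈ principalMinor charMatrix n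
    charPoly≈principalMinor n = det-cong n entry
      where
      entry : ∀ i j → x * idMat R n i j - triMat R e n i j ≈ charMatrix (toℕ i) (toℕ j)
      entry i j with toℕ i ≟ toℕ j | suc (toℕ i) ≟ toℕ j | toℕ i ≟ suc (toℕ j)
      ... | yes _ | _     | _     = refl
      ... | no _  | yes _ | _     = refl
      ... | no _  | no _  | yes _ = refl
      ... | no _  | no _  | no _  = refl

    x*0-1≈-1 : x * 0# - 1# ≈ - 1#
    x*0-1≈-1 = trans (+-congʳ (zeroʳ x)) (+-identityˡ _)

    charMatrix-diag : ∀ k → charMatrix k k ≈ x - intR R (e k)
    charMatrix-diag k with k ≟ k
    ... | yes _  = +-congʳ (*-identityʳ x)
    ... | no k≢k = ⊥-elim (k≢k ≡.refl)

    charMatrix-super : ∀ k → charMatrix k (suc k) ≈ - 1#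
    charMatrix-super k with k ≟ suc k | suc k ≟ suc k
    ... | yes k≡1+k | _ = ⊥-elim (1+n≢n (≡.sym k≡1+k))
    ... | no _ | yes _  = x*0-1≈-1
    ... | no _ | no ≢   = ⊥-elim (≢ ≡.refl)

    charMatrix-sub : ∀ k → charMatrix (suc k) k ≈ - 1#
    charMatrix-sub k with suc k ≟ k | suc (suc k) ≟ k | suc k ≟ suc k
    ... | yes 1+k≡k | _ | _    = ⊥-elim (1+n≢n 1+k≡k)
    ... | no _ | yes 2+k≡k | _ = ⊥-elim (>⇒≢ (m<n⇒m<1+n (n<1+n k)) 2+k≡k)
    ... | no _ | no _ | yes _  = x*0-1≈-1
    ... | no _ | no _ | no ≢   = ⊥-elim (≢ ≡.refl)

    charMatrix-zero : ∀ {a b} → a ≢ b → suc a ≢ b → a ≢ suc b → charMatrix a b ≈ 0#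
    charMatrix-zero {a} {b} a≢b 1+a≢b a≢1+b with a ≟ b | suc a ≟ b | a ≟ suc b
    ... | yes a≡b | _ | _         = ⊥-elim (a≢b a≡b)
    ... | no _ | yes 1+a≡b | _    = ⊥-elim (1+a≢b 1+a≡b)
    ... | no _ | no _ | yes a≡1+b = ⊥-elim (a≢1+b a≡1+b)
    ... | no _ | no _ | no _      = trans (+-cong (zeroʳ x) -0#≈0#) (+-identityʳ 0#)

    charMatrix-tridiagonal : Tridiagonal charMatrix
    charMatrix-tridiagonal 1+i<j =
      charMatrix-zero (<⇒≢ i<j) (<⇒≢ 1+i<j) (<⇒≢ (m<n⇒m<1+n i<j)) ,
      charMatrix-zero (>⇒≢ i<j) (>⇒≢ (m<n⇒m<1+n i<j)) (>⇒≢ 1+i<j)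
      where i<j = <⇒≤ 1+i<j

    charMatrix-offDiagonal : ∀ k → charMatrix k (suc k) * charMatrix (suc k) k ≈ 1#
    charMatrix-offDiagonal k = begin
      charMatrix k (suc k) * charMatrix (suc k) k  ≈⟨ *-cong (charMatrix-super k) (charMatrix-sub k) ⟩
      - 1# * - 1#                                  ≈⟨ -1*x≈-x (- 1#) ⟩
      - - 1#                                       ≈⟨ -‿involutive 1# ⟩
      1#                                           ∎

    charPoly-triMat-1 : charPoly R 1 (triMat R e 1) x ≈ x - intR R (e 0)
    charPoly-triMat-1 = begin
      charPoly R 1 (triMat R e 1) x  ≈⟨ charPoly≈principalMinor 1 ⟩
      principalMinor charMatrix 1    ≈⟨ principalMinor-1 charMatrix ⟩
      charMatrix 0 0                 ≈⟨ charMatrix-diag 0 ⟩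
      x - intR R (e 0)               ∎

    charPoly-triMat-recurrence : ∀ n →
      charPoly R (2 ℕ.+ n) (triMat R e (2 ℕ.+ n)) x ≈
        (x - intR R (e (suc n))) * charPoly R (suc n) (triMat R e (suc n)) x - charPoly R n (triMat R e n) x
    charPoly-triMat-recurrence n = begin
      charPoly R (2 ℕ.+ n) (triMat R e (2 ℕ.+ n)) x
        ≈⟨ charPoly≈principalMinor (2 ℕ.+ n) ⟩
      principalMinor C (2 ℕ.+ n)
        ≈⟨ principalMinor-recurrence charMatrix-tridiagonal n ⟩
      C (suc n) (suc n) * principalMinor C (suc n) - (C n (suc n) * C (suc n) n) * principalMinor C n
        ≈⟨ +-cong (*-congʳ (charMatrix-diag (suc n)))
                  (-‿cong (trans (*-congʳ (charMatrix-offDiagonal n)) (*-identityˡ _))) ⟩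
      (x - intR R (e (suc n))) * principalMinor C (suc n) - principalMinor C n
        ≈⟨ +-cong (*-congˡ (charPoly≈principalMinor (suc n))) (-‿cong (charPoly≈principalMinor n)) ⟨
      (x - intR R (e (suc n))) * charPoly R (suc n) (triMat R e (suc n)) x - charPoly R n (triMat R e n) x ∎
      where C = charMatrix

  -- Perturbed Chebyshev recurrences

  module _ (y : Carrier) where

    U₋₁ : ℕ → Carrier
    U₋₁ zero = 0#
    U₋₁ (suc m) = cheb R m y

    U₋₁-recurrence : ∀ m → U₋₁ (2 ℕ.+ m) ≈ (y + y) * U₋₁ (suc m) - U₋₁ m
    U₋₁-recurrence zero = solve 1 (λ y → y :+ y := (y :+ y) :* :1 :- :0) refl y
    U₋₁-recurrence (suc m) = refl

    U₋₁-step : ∀ {k n} → k ≤ n → U₋₁ (2 ℕ.+ n ∸ k) ≈ (y + y) * U₋₁ (suc n ∸ k) - U₋₁ (n ∸ k)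
    U₋₁-step {k} {n} k≤n = begin
      U₋₁ (2 ℕ.+ n ∸ k)                          ≡⟨ ≡.cong U₋₁ (+-∸-assoc 2 k≤n) ⟩
      U₋₁ (2 ℕ.+ (n ∸ k))                        ≈⟨ U₋₁-recurrence (n ∸ k) ⟩
      (y + y) * U₋₁ (suc (n ∸ k)) - U₋₁ (n ∸ k)  ≡⟨ ≡.cong (λ m → (y + y) * U₋₁ m - U₋₁ (n ∸ k)) (+-∸-assoc 1 k≤n) ⟨
      (y + y) * U₋₁ (suc n ∸ k) - U₋₁ (n ∸ k)    ∎

    convolution : (ℕ → Carrier) → ℕ → Carrier
    convolution a n = Σ< R n (λ k → a k * U₋₁ (n ∸ k))

    convolution-extend : ∀ a n → Σ< R (suc n) (λ k → a k * U₋₁ (n ∸ k)) ≈ convolution a n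
    convolution-extend a n = begin
      convolution a n + a n * U₋₁ (n ∸ n)  ≡⟨ ≡.cong (λ m → convolution a n + a n * U₋₁ m) (n∸n≡0 n) ⟩
      convolution a n + a n * 0#           ≈⟨ +-congˡ (zeroʳ (a n)) ⟩
      convolution a n + 0#                 ≈⟨ +-identityʳ _ ⟩
      convolution a n                      ∎

    convolution-recurrence : ∀ a n →
      convolution a (2 ℕ.+ n) ≈ (y + y) * convolution a (suc n) - convolution a n + a (suc n)
    convolution-recurrence a n = begin
      Σ< R (suc n) (λ k → a k * U₋₁ (2 ℕ.+ n ∸ k)) + a (suc n) * U₋₁ (suc n ∸ n)
        ≈⟨ +-cong (Σ<-cong (suc n) λ k<1+n → *-congˡ (U₋₁-step (s≤s⁻¹ k<1+n)))
                  (reflexive (≡.cong (λ m → a (suc n) * U₋₁ m) (m+n∸n≡m 1 n))) ⟩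
      Σ< R (suc n) (λ k → a k * ((y + y) * U₋₁ (suc n ∸ k) - U₋₁ (n ∸ k))) + a (suc n) * 1#
        ≈⟨ +-cong (Σ<-cong (suc n) λ {k} _ → distribute (a k) (U₋₁ (suc n ∸ k)) (U₋₁ (n ∸ k)))
                  (*-identityʳ _) ⟩
      Σ< R (suc n) (λ k → (y + y) * (a k * U₋₁ (suc n ∸ k)) - a k * U₋₁ (n ∸ k)) + a (suc n)
        ≈⟨ +-congʳ (Σ<-linear (suc n) (y + y) _ _) ⟩
      (y + y) * convolution a (suc n) - Σ< R (suc n) (λ k → a k * U₋₁ (n ∸ k)) + a (suc n)
        ≈⟨ +-congʳ (+-congˡ (-‿cong (convolution-extend a n))) ⟩
      (y + y) * convolution a (suc n) - convolution a n + a (suc n) ∎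
      where
      distribute : ∀ α u v → α * ((y + y) * u - v) ≈ (y + y) * (α * u) - α * v
      distribute = solve 4 (λ y α u v → α :* ((y :+ y) :* u :- v) := (y :+ y) :* (α :* u) :- α :* v) refl y

    convolution≈Σ<cheb : ∀ a n → convolution a n ≈ Σ< R n (λ k → a k * cheb R (n ∸ k ∸ 1) y)
    convolution≈Σ<cheb a n = Σ<-cong n λ k<n → *-congˡ (reflexive (U₋₁-pred (m<n⇒0<n∸m k<n)))
      where
      U₋₁-pred : ∀ {d} → 0 < d → U₋₁ d ≡ cheb R (d ∸ 1) y
      U₋₁-pred {suc d} _ = ≡.refl

    perturbed-chebyshev : (b g : ℕ → Carrier) → g 0 ≈ 1# → g 1 ≈ (y + y + b 0) * g 0 →
      (∀ n → g (2 ℕ.+ n) ≈ (y + y + b (suc n)) * g (suc n) - g n) →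
      ∀ n → g n ≈ cheb R n y + Σ< R n (λ k → (b k * g k) * cheb R (n ∸ k ∸ 1) y)
    perturbed-chebyshev b g g₀ g₁ g-rec n = trans (solution n) (+-congˡ (convolution≈Σ<cheb a n))
      where
      a : ℕ → Carrier
      a k = b k * g k

      solution : ∀ n → g n ≈ U₋₁ (suc n) + convolution a n
      solution zero = trans g₀ (sym (+-identityʳ 1#))
      solution (suc zero) = begin
        g 1                              ≈⟨ g₁ ⟩
        (y + y + b 0) * g 0              ≈⟨ solve 3 (λ y β γ → (y :+ y :+ β) :* γ
                                                         := (y :+ y) :* γ :+ (:0 :+ β :* γ :* :1))
                                                  refl y (b 0) (g 0) ⟩
        (y + y) * g 0 + (0# + a 0 * 1#)  ≈⟨ +-congʳ (trans (*-congˡ g₀) (*-identityʳ _)) ⟩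
        (y + y) + convolution a 1        ∎
      solution (suc (suc n)) = begin
        g (2 ℕ.+ n)
          ≈⟨ g-rec n ⟩
        (y + y + b (suc n)) * g (suc n) - g n
          ≈⟨ solve 4 (λ y β γ₁ γ₀ → (y :+ y :+ β) :* γ₁ :- γ₀ := (y :+ y) :* γ₁ :- γ₀ :+ β :* γ₁)
                   refl y (b (suc n)) (g (suc n)) (g n) ⟩
        (y + y) * g (suc n) - g n + a (suc n)
          ≈⟨ +-congʳ (+-cong (*-congˡ (solution (suc n))) (-‿cong (solution n))) ⟩
        (y + y) * (U₋₁ (2 ℕ.+ n) + C₁) - (U₋₁ (suc n) + C₀) + a (suc n)
          ≈⟨ solve 6 (λ y U₁ C₁ U₀ C₀ α →
               (y :+ y) :* (U₁ :+ C₁) :- (U₀ :+ C₀) :+ α := ((y :+ y) :* U₁ :- U₀) :+ ((y :+ y) :* C₁ :- C₀ :+ α))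
               refl y (U₋₁ (2 ℕ.+ n)) C₁ (U₋₁ (suc n)) C₀ (a (suc n)) ⟩
        ((y + y) * U₋₁ (2 ℕ.+ n) - U₋₁ (suc n)) + ((y + y) * C₁ - C₀ + a (suc n))
          ≈⟨ +-cong (U₋₁-recurrence (suc n)) (convolution-recurrence a n) ⟨
        U₋₁ (3 ℕ.+ n) + convolution a (2 ℕ.+ n) ∎
        where C₁ = convolution a (suc n); C₀ = convolution a n

lemma4p6 : {c ℓ : Level} (R : CommutativeRing c ℓ) →
    let open CommutativeRing R in
    (e : ℕ → ℤ) (μ y : Carrier) (n : ℕ) →
      fPoly R e μ n y
        ≈ cheb R n y
          + Σ< R n (λ k → ((μ - intR R (e k)) * fPoly R e μ k y) * cheb R (n ∸ k ∸ 1) y)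
lemma4p6 R e μ y = perturbed-chebyshev R y (λ k → μ - intR R (e k)) (λ k → fPoly R e μ k y) refl f₁ f-rec
  where
  open CommutativeRing R
  x : Carrier
  x = (y + y) + μ
  f₁ : fPoly R e μ 1 y ≈ (y + y + (μ - intR R (e 0))) * 1#
  f₁ = trans (charPoly-triMat-1 R x e) (trans (+-assoc _ _ _) (sym (*-identityʳ _)))
  f-rec : ∀ n → fPoly R e μ (2 ℕ.+ n) y
                  ≈ (y + y + (μ - intR R (e (suc n)))) * fPoly R e μ (suc n) y - fPoly R e μ n y
  f-rec n = trans (charPoly-triMat-recurrence R x e n) (+-congʳ (*-congʳ (+-assoc _ _ _)))
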